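{- If the congruence $\equiv$ is defined by a confluent rewrite system that rewrites terms to terms and atomic propositions to propositions, then there is no normal proof term $\pi$ such that $\vdash_\equiv\pi:\bot$ is derivable in $\mu\mathrm{NJ}$ modulo $\equiv$ (with empty context).
   Context: Formulas over simply typed $\lambda$-terms modulo $\beta\eta$: $P ::= \top \mid \bot \mid P\supset Q \mid P\wedge Q \mid P\vee Q \mid \forall x.P \mid \exists x.P \mid t=t' \mid \mu B\vec t \mid \nu B\vec t \mid p\vec t \mid a\vec t$ ($a\vec t$ atomic; $B=\lambda p\lambda\vec x.P$ with $p$ positive). $\mathrm{csu}(u,v)$: a set of unifiers $\theta_i$ ($u\theta_i\equiv v\theta_i$) such that every unifier is some $\theta_i\theta'$. Proof terms: $\alpha$, $\langle\rangle$, $\delta_\bot(\pi)$, $\lambda\alpha.\pi$, $\pi\pi'$, $\langle\pi,\pi'\rangle$, $\mathrm{proj}_i(\pi)$, $\mathrm{in}_i(\pi)$, $\delta_\vee(\pi,\alpha.\pi_1,\beta.\pi_2)$, $\lambda x.\pi$, $\pi t$, $\langle t,\pi\rangle$, $\delta_\exists(\pi,x.\alpha.\pi')$, $\mathrm{refl}(t)$, $\delta_=(\Gamma,\theta,\sigma,u,v,Q,\pi;(\theta'_i.\pi_i)_i)$, $\mu(B,\vec t,\pi)$, $\delta_\mu(\pi,\vec x.\alpha.\pi')$, $\nu(\pi,\vec x.\alpha.\pi')$, $\delta_\nu(B,\vec t,\pi)$. Typing (bound variables fresh): $\alpha:P$ if $(\alpha:Q)\in\Gamma$, $P\equiv Q$;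 $\langle\rangle:P$ if $P\equiv\top$; $\delta_\bot(\pi):P$ from $\pi:\bot$; $\lambda\alpha.\pi:P$ from $\Gamma,\alpha:P_1\vdash\pi:P_2$, $P\equiv P_1\supset P_2$; $\pi\pi':P$ from $\pi:Q\supset P$, $\pi':Q$; $\langle\pi_1,\pi_2\rangle:P$ from $\pi_j:P_j$, $P\equiv P_1\wedge P_2$; $\mathrm{proj}_i(\pi):P'$ from $\pi:P_1\wedge P_2$, $P'\equiv P_i$; $\mathrm{in}_i(\pi):P$ from $\pi:P_i$, $P\equiv P_1\vee P_2$; $\delta_\vee(\pi,\alpha.\pi_1,\beta.\pi_2):P$ from $\pi:P_1\vee P_2$, $\Gamma,\alpha:P_1\vdash\pi_1:P$, $\Gamma,\beta:P_2\vdash\pi_2:P$; $\lambda x.\pi:P$ from $\pi:Q$, $P\equiv\forall x.Q$; $\pi t:P$ from $\pi:\forall x.Q$, $P\equiv Q[t/x]$; $\langle t,\pi\rangle:P$ from $\pi:Q[t/x]$, $P\equiv\exists x.Q$; $\delta_\exists(\pi,x.\alpha.\pi'):P$ from $\pi:\exists x.Q$, $\Gamma,\alpha:Q\vdash\pi':P$; $\mathrm{refl}(t):P$ if $P\equiv(t=t)$; $\Gamma'\vdash\delta_=(\Gamma,\theta,\sigma,u,v,Q,\pi;(\theta'_i.\pi_i)_i):P$ from $\Gamma'\vdash\pi:u\theta=v\theta$, $\Gamma'\vdash\sigma(\beta):(\Gamma\theta)(\beta)$ for all $\beta$, $\Gamma\theta'_i\vdash\pi_i:Q\theta'_i$ for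 all $i$, $(\theta'_i)_i$ a $\mathrm{csu}(u,v)$, $P\equiv Q\theta$; $\mu(B,\vec t,\pi):P$ from $\pi:B(\mu B)\vec t$, $P\equiv\mu B\vec t$; $\delta_\mu(\pi,\vec x.\alpha.\pi'):P$ from $\pi:\mu B\vec t$, $\Gamma,\alpha:BS\vec x\vdash\pi':S\vec x$, $P\equiv S\vec t$; $\nu(\pi,\vec x.\alpha.\pi'):P$ from $\pi:S\vec t$, $\Gamma,\alpha:S\vec x\vdash\pi':BS\vec x$, $P\equiv\nu B\vec t$; $\delta_\nu(B,\vec t,\pi):P$ from $\pi:\nu B\vec t$, $P\equiv B(\nu B)\vec t$. A proof term is normal if it contains no redex, where the redexes are: $(\lambda\alpha.\pi)\pi'$; $\mathrm{proj}_i\langle\pi_1,\pi_2\rangle$; $\delta_\vee(\mathrm{in}_i(\pi),\ldots)$; $(\lambda x.\pi)t$; $\delta_\exists(\langle t,\pi\rangle,\ldots)$; $\delta_\mu(\mu(B,\vec t,\pi),\ldots)$; $\delta_\nu(B,\vec t,\nu(\pi,\ldots))$; and $\delta_=(\Gamma,\theta,\sigma,u,v,Q,\mathrm{refl}(w);(\theta'_i.\pi_i)_i)$ when $\theta=\theta'_i\theta''$ for some $i$ and $\theta''$. -}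

module Defs where

open import Data.List using (List; []; _∷_; _++_; map)
open import Data.List.Relation.Unary.All using (All; []; _∷_) renaming (map to mapAll)
open import Data.Product using (Σ; ∃; _×_; _,_)
open import Data.Sum using (_⊎_)
open import Data.Unit using (⊤)
open import Data.Empty using (⊥)
open import Relation.Nullary using (¬_)
open import Relation.Binary.Construct.Closure.ReflexiveTransitive using (Star)
open import Relation.Binary.Construct.Closure.Equivalence using (EqClosure)

infix 4 _∋_
data _∋_ {X : Set} : List X → X → Set where
  here  : ∀ {x xs} → (x ∷ xs) ∋ x
  there : ∀ {x y xs} → xs ∋ x → (y ∷ xs) ∋ x

liftR : ∀ {X : Set} {xs ys : List X} {z : X} →
        (∀ {x} → xs ∋ x → ys ∋ x) → ∀ {x} → (z ∷ xs) ∋ x → (z ∷ ys) ∋ x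
liftR ρ here      = here
liftR ρ (there v) = there (ρ v)

data Ty (S : Set) : Set where
  base : S → Ty S
  _⇒_  : Ty S → Ty S → Ty S

record Signature : Set₁ where
  field
    Sort    : Set
    Const   : Set
    constTy : Const → Ty Sort
    Pred    : Set
    predAr  : Pred → List (Ty Sort)

module Syntax (sig : Signature) where
  open Signature sig public

  Type  = Ty Sort
  Ctx   = List Type
  Arity = List Type

  data Tm : Ctx → Type → Set where
    var : ∀ {Γ A} → Γ ∋ A → Tm Γ A
    con : ∀ {Γ} (c : Const) → Tm Γ (constTy c)
    app : ∀ {Γ A B} → Tm Γ (A ⇒ B) → Tm Γ A → Tm Γ B
    lam : ∀ {Γ A B} → Tm (A ∷ Γ) B → Tm Γ (A ⇒ B)

  Tms : Ctx → Arity → Set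
  Tms Γ as = All (Tm Γ) as

  Ren : Ctx → Ctx → Set
  Ren Γ Δ = ∀ {A} → Γ ∋ A → Δ ∋ A

  ren : ∀ {Γ Δ A} → Ren Γ Δ → Tm Γ A → Tm Δ A
  ren ρ (var x)   = var (ρ x)
  ren ρ (con c)   = con c
  ren ρ (app t u) = app (ren ρ t) (ren ρ u)
  ren ρ (lam t)   = lam (ren (liftR ρ) t)

  extN : ∀ {Γ Δ} (as : Arity) → Ren Γ Δ → Ren (as ++ Γ) (as ++ Δ)
  extN []       ρ = ρ
  extN (a ∷ as) ρ = liftR (extN as ρ)

  wkN : ∀ {Γ} (as : Arity) → Ren Γ (as ++ Γ)
  wkN []       x = x
  wkN (a ∷ as) x = there (wkN as x)

  Sub : Ctx → Ctx → Set
  Sub Γ Δ = ∀ {A} → Γ ∋ A → Tm Δ A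

  exts : ∀ {Γ Δ A} → Sub Γ Δ → Sub (A ∷ Γ) (A ∷ Δ)
  exts σ here      = var here
  exts σ (there x) = ren there (σ x)

  sub : ∀ {Γ Δ A} → Sub Γ Δ → Tm Γ A → Tm Δ A
  sub σ (var x)   = σ x
  sub σ (con c)   = con c
  sub σ (app t u) = app (sub σ t) (sub σ u)
  sub σ (lam t)   = lam (sub (exts σ) t)

  extsN : ∀ {Γ Δ} (as : Arity) → Sub Γ Δ → Sub (as ++ Γ) (as ++ Δ)
  extsN []       σ = σ
  extsN (a ∷ as) σ = exts (extsN as σ)

  -- composition: (θ'' ∘ˢ θ') x = (x θ') θ''   (i.e. the paper's θ' θ'')
  _∘ˢ_ : ∀ {X Y Z} → Sub Y Z → Sub X Y → Sub X Z
  (θ'' ∘ˢ θ') x = sub θ'' (θ' x)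

  _⊕_ : ∀ {as Γ Δ} → Tms Δ as → Sub Γ Δ → Sub (as ++ Γ) Δ
  ([]       ⊕ σ) x         = σ x
  ((t ∷ ts) ⊕ σ) here      = t
  ((t ∷ ts) ⊕ σ) (there x) = (ts ⊕ σ) x

  varsL : ∀ {Γ} (as : Arity) → Tms (as ++ Γ) as
  varsL []       = []
  varsL (a ∷ as) = var here ∷ mapAll (ren there) (varsL as)

  _[_]₀ : ∀ {Γ A B} → Tm (A ∷ Γ) B → Tm Γ A → Tm Γ B
  t [ u ]₀ = sub ((u ∷ []) ⊕ var) t

  infix 4 _≈βη_
  data _≈βη_ : ∀ {Γ A} → Tm Γ A → Tm Γ A → Set where
    β      : ∀ {Γ A B} {t : Tm (A ∷ Γ) B} {u : Tm Γ A} → app (lam t) u ≈βη (t [ u ]₀)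
    η      : ∀ {Γ A B} {t : Tm Γ (A ⇒ B)} → t ≈βη lam (app (ren there t) (var here))
    ≈refl  : ∀ {Γ A} {t : Tm Γ A} → t ≈βη t
    ≈sym   : ∀ {Γ A} {t u : Tm Γ A} → t ≈βη u → u ≈βη t
    ≈trans : ∀ {Γ A} {t u w : Tm Γ A} → t ≈βη u → u ≈βη w → t ≈βη w
    appᶜ   : ∀ {Γ A B} {t t' : Tm Γ (A ⇒ B)} {u u' : Tm Γ A} →
             t ≈βη t' → u ≈βη u' → app t u ≈βη app t' u'
    lamᶜ   : ∀ {Γ A B} {t t' : Tm (A ∷ Γ) B} → t ≈βη t' → lam t ≈βη lam t'

  _≈ˢ_ : ∀ {X Z} → Sub X Z → Sub X Z → Set
  θ ≈ˢ θ' = ∀ {A} (x : _ ∋ A) → θ x ≈βη θ' x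

  -- Fm Γ Φ Ψ : term context Γ; predicate variables Φ occurring
  -- at positive positions, Ψ at negative positions.  Only variables in Φ
  -- may be used, so a μ/ν-bound p (put in Φ) occurs only positively.
  data Fm : Ctx → List Arity → List Arity → Set where
    ⊤ᶠ ⊥ᶠ    : ∀ {Γ Φ Ψ} → Fm Γ Φ Ψ
    _⊃_      : ∀ {Γ Φ Ψ} → Fm Γ Ψ Φ → Fm Γ Φ Ψ → Fm Γ Φ Ψ
    _∧ᶠ_ _∨ᶠ_ : ∀ {Γ Φ Ψ} → Fm Γ Φ Ψ → Fm Γ Φ Ψ → Fm Γ Φ Ψ
    Forall Exists : ∀ {Γ Φ Ψ} (A : Type) → Fm (A ∷ Γ) Φ Ψ → Fm Γ Φ Ψ
    _≐_      : ∀ {Γ Φ Ψ A} → Tm Γ A → Tm Γ A → Fm Γ Φ Ψ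
    μᶠ νᶠ    : ∀ {Γ Φ Ψ} (as : Arity) → Fm (as ++ Γ) (as ∷ Φ) Ψ → Tms Γ as → Fm Γ Φ Ψ
    pvar     : ∀ {Γ Φ Ψ as} → Φ ∋ as → Tms Γ as → Fm Γ Φ Ψ
    atom     : ∀ {Γ Φ Ψ} (c : Pred) → Tms Γ (predAr c) → Fm Γ Φ Ψ

  -- closed (no free predicate variable) formulas, and bodies B = λpλx⃗.P
  Form : Ctx → Set
  Form Γ = Fm Γ [] []

  Body : Ctx → Arity → Set
  Body Γ as = Fm (as ++ Γ) (as ∷ []) []

  frenF : ∀ {Γ Δ Φ Ψ} → Ren Γ Δ → Fm Γ Φ Ψ → Fm Δ Φ Ψ
  frenF ρ ⊤ᶠ = ⊤ᶠ
  frenF ρ ⊥ᶠ = ⊥ᶠ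
  frenF ρ (A ⊃ B) = frenF ρ A ⊃ frenF ρ B
  frenF ρ (A ∧ᶠ B) = frenF ρ A ∧ᶠ frenF ρ B
  frenF ρ (A ∨ᶠ B) = frenF ρ A ∨ᶠ frenF ρ B
  frenF ρ (Forall A F) = Forall A (frenF (liftR ρ) F)
  frenF ρ (Exists A F) = Exists A (frenF (liftR ρ) F)
  frenF ρ (t ≐ u) = ren ρ t ≐ ren ρ u
  frenF ρ (μᶠ as B ts) = μᶠ as (frenF (extN as ρ) B) (mapAll (ren ρ) ts)
  frenF ρ (νᶠ as B ts) = νᶠ as (frenF (extN as ρ) B) (mapAll (ren ρ) ts)
  frenF ρ (pvar x ts) = pvar x (mapAll (ren ρ) ts)
  frenF ρ (atom c ts) = atom c (mapAll (ren ρ) ts)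

  fsub : ∀ {Γ Δ Φ Ψ} → Sub Γ Δ → Fm Γ Φ Ψ → Fm Δ Φ Ψ
  fsub σ ⊤ᶠ = ⊤ᶠ
  fsub σ ⊥ᶠ = ⊥ᶠ
  fsub σ (A ⊃ B) = fsub σ A ⊃ fsub σ B
  fsub σ (A ∧ᶠ B) = fsub σ A ∧ᶠ fsub σ B
  fsub σ (A ∨ᶠ B) = fsub σ A ∨ᶠ fsub σ B
  fsub σ (Forall A F) = Forall A (fsub (exts σ) F)
  fsub σ (Exists A F) = Exists A (fsub (exts σ) F)
  fsub σ (t ≐ u) = sub σ t ≐ sub σ u
  fsub σ (μᶠ as B ts) = μᶠ as (fsub (extsN as σ) B) (mapAll (sub σ) ts)
  fsub σ (νᶠ as B ts) = νᶠ as (fsub (extsN as σ) B) (mapAll (sub σ) ts)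
  fsub σ (pvar x ts) = pvar x (mapAll (sub σ) ts)
  fsub σ (atom c ts) = atom c (mapAll (sub σ) ts)

  _[_]ᶠ : ∀ {Γ A Φ Ψ} → Fm (A ∷ Γ) Φ Ψ → Tm Γ A → Fm Γ Φ Ψ
  Q [ t ]ᶠ = fsub ((t ∷ []) ⊕ var) Q

  inst : ∀ {Γ as} → Fm (as ++ Γ) [] [] → Tms Γ as → Form Γ
  inst S ts = fsub (ts ⊕ var) S

  pren : ∀ {Γ Φ Ψ Φ' Ψ'} → (∀ {as} → Φ ∋ as → Φ' ∋ as) → (∀ {as} → Ψ ∋ as → Ψ' ∋ as) →
         Fm Γ Φ Ψ → Fm Γ Φ' Ψ'
  pren r s ⊤ᶠ = ⊤ᶠ
  pren r s ⊥ᶠ = ⊥ᶠ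
  pren r s (A ⊃ B) = pren s r A ⊃ pren r s B
  pren r s (A ∧ᶠ B) = pren r s A ∧ᶠ pren r s B
  pren r s (A ∨ᶠ B) = pren r s A ∨ᶠ pren r s B
  pren r s (Forall A F) = Forall A (pren r s F)
  pren r s (Exists A F) = Exists A (pren r s F)
  pren r s (t ≐ u) = t ≐ u
  pren r s (μᶠ as B ts) = μᶠ as (pren (liftR r) s B) ts
  pren r s (νᶠ as B ts) = νᶠ as (pren (liftR r) s B) ts
  pren r s (pvar x ts) = pvar (r x) ts
  pren r s (atom c ts) = atom c ts

  noVar : ∀ {X : Set} {x : X} {ys : List X} → [] ∋ x → ys ∋ x
  noVar ()

  pweak : ∀ {Γ Φ Ψ} → Form Γ → Fm Γ Φ Ψ
  pweak = pren noVar noVar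

  data PVal (Γ : Ctx) (Φ : List Arity) (as : Arity) : Set where
    keep : Φ ∋ as → PVal Γ Φ as
    put  : Fm (as ++ Γ) [] [] → PVal Γ Φ as

  record PSub (Γ : Ctx) (Φ Ψ Φ' Ψ' : List Arity) : Set where
    field
      pos : ∀ {as} → Φ ∋ as → PVal Γ Φ' as
      neg : ∀ {as} → Ψ ∋ as → PVal Γ Ψ' as
  open PSub

  pvRen : ∀ {Γ Δ Φ as} → Ren Γ Δ → PVal Γ Φ as → PVal Δ Φ as
  pvRen ρ (keep x) = keep x
  pvRen {as = as} ρ (put S) = put (frenF (extN as ρ) S)

  psRen : ∀ {Γ Δ Φ Ψ Φ' Ψ'} → Ren Γ Δ → PSub Γ Φ Ψ Φ' Ψ' → PSub Δ Φ Ψ Φ' Ψ'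
  pos (psRen ρ s) x = pvRen ρ (pos s x)
  neg (psRen ρ s) x = pvRen ρ (neg s x)

  psSwap : ∀ {Γ Φ Ψ Φ' Ψ'} → PSub Γ Φ Ψ Φ' Ψ' → PSub Γ Ψ Φ Ψ' Φ'
  pos (psSwap s) = neg s
  neg (psSwap s) = pos s

  pvThere : ∀ {Γ Φ as bs} → PVal Γ Φ as → PVal Γ (bs ∷ Φ) as
  pvThere (keep x) = keep (there x)
  pvThere (put S)  = put S

  psLift : ∀ {Γ Φ Ψ Φ' Ψ' bs} → PSub Γ Φ Ψ Φ' Ψ' → PSub Γ (bs ∷ Φ) Ψ (bs ∷ Φ') Ψ'
  pos (psLift s) here      = keep here
  pos (psLift s) (there x) = pvThere (pos s x)
  neg (psLift s) x         = neg s x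

  psub : ∀ {Γ Φ Ψ Φ' Ψ'} → PSub Γ Φ Ψ Φ' Ψ' → Fm Γ Φ Ψ → Fm Γ Φ' Ψ'
  psub s ⊤ᶠ = ⊤ᶠ
  psub s ⊥ᶠ = ⊥ᶠ
  psub s (A ⊃ B) = psub (psSwap s) A ⊃ psub s B
  psub s (A ∧ᶠ B) = psub s A ∧ᶠ psub s B
  psub s (A ∨ᶠ B) = psub s A ∨ᶠ psub s B
  psub s (Forall A F) = Forall A (psub (psRen there s) F)
  psub s (Exists A F) = Exists A (psub (psRen there s) F)
  psub s (t ≐ u) = t ≐ u
  psub s (μᶠ as B ts) = μᶠ as (psub (psLift (psRen (wkN as) s)) B) ts
  psub s (νᶠ as B ts) = νᶠ as (psub (psLift (psRen (wkN as) s)) B) ts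
  psub s (pvar x ts) with pos s x
  ... | keep y = pvar y ts
  ... | put S  = pweak (inst S ts)
  psub s (atom c ts) = atom c ts

  psub₀ : ∀ {Γ as} → Fm (as ++ Γ) [] [] → Fm Γ (as ∷ []) [] → Form Γ
  psub₀ {Γ} {as} S B = psub s B
    where
    s : PSub Γ (as ∷ []) [] [] []
    pos s here = put S
    pos s (there ())
    neg s ()

  -- B S x⃗, for B = λpλx⃗.P and S = λx⃗.S (both with x⃗ the first variables)
  applyB : ∀ {Γ as} → Body Γ as → Fm (as ++ Γ) [] [] → Form (as ++ Γ)
  applyB {as = as} B S = psub₀ (frenF (extN as (wkN as)) S) B

  wk2 : ∀ {Γ} (as : Arity) → Ren Γ (as ++ (as ++ Γ))
  wk2 as x = wkN as (wkN as x)

  -- B (μB) t⃗  and  B (νB) t⃗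
  unfoldμ : ∀ {Γ as} → Body Γ as → Tms Γ as → Form Γ
  unfoldμ {as = as} B ts = inst (psub₀ (μᶠ as (frenF (extN as (wk2 as)) B) (varsL as)) B) ts

  unfoldν : ∀ {Γ as} → Body Γ as → Tms Γ as → Form Γ
  unfoldν {as = as} B ts = inst (psub₀ (νᶠ as (frenF (extN as (wk2 as)) B) (varsL as)) B) ts

  record TRule : Set where
    field
      tctx : Ctx
      tty  : Type
      tlhs : Tm tctx tty
      trhs : Tm tctx tty

  record FRule : Set where
    field
      fctx  : Ctx
      fpred : Pred
      fargs : Tms fctx (predAr fpred)
      frhs  : Form fctx

  record RewriteSystem : Set₁ where
    field
      TIx : Set
      tr  : TIx → TRule
      FIx : Set
      fr  : FIx → FRule

module Logic (sig : Signature) (R : Syntax.RewriteSystem sig) where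
  open Syntax sig
  open RewriteSystem R
  open TRule
  open FRule

  infix 4 _⟶ₜ_ _⇝_ _⇝ˢ_ _⟶ᶠ_ _≡ₜ_ _≅_
  data _⟶ₜ_ : ∀ {Γ A} → Tm Γ A → Tm Γ A → Set where
    rw   : ∀ {Γ} (i : TIx) (θ : Sub (tctx (tr i)) Γ) → sub θ (tlhs (tr i)) ⟶ₜ sub θ (trhs (tr i))
    appˡ : ∀ {Γ A B} {t t' : Tm Γ (A ⇒ B)} {u : Tm Γ A} → t ⟶ₜ t' → app t u ⟶ₜ app t' u
    appʳ : ∀ {Γ A B} {t : Tm Γ (A ⇒ B)} {u u' : Tm Γ A} → u ⟶ₜ u' → app t u ⟶ₜ app t u'
    lamᶜ : ∀ {Γ A B} {t t' : Tm (A ∷ Γ) B} → t ⟶ₜ t' → lam t ⟶ₜ lam t'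

  _⇝_ : ∀ {Γ A} → Tm Γ A → Tm Γ A → Set
  t ⇝ u = (t ≈βη u) ⊎ (t ⟶ₜ u)

  data _⇝ˢ_ : ∀ {Γ as} → Tms Γ as → Tms Γ as → Set where
    hd : ∀ {Γ a as} {t t' : Tm Γ a} {ts : Tms Γ as} → t ⇝ t' → (t ∷ ts) ⇝ˢ (t' ∷ ts)
    tl : ∀ {Γ a as} {t : Tm Γ a} {ts ts' : Tms Γ as} → ts ⇝ˢ ts' → (t ∷ ts) ⇝ˢ (t ∷ ts')

  data _⟶ᶠ_ : ∀ {Γ Φ Ψ} → Fm Γ Φ Ψ → Fm Γ Φ Ψ → Set where
    rw    : ∀ {Γ Φ Ψ} (i : FIx) (θ : Sub (fctx (fr i)) Γ) →
            atom (fpred (fr i)) (mapAll (sub θ) (fargs (fr i))) ⟶ᶠ pweak {Φ = Φ} {Ψ} (fsub θ (frhs (fr i)))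
    atomᶜ : ∀ {Γ Φ Ψ c} {ts ts' : Tms Γ (predAr c)} → ts ⇝ˢ ts' → atom {Φ = Φ} {Ψ} c ts ⟶ᶠ atom c ts'
    pvarᶜ : ∀ {Γ Φ Ψ as} {x : Φ ∋ as} {ts ts' : Tms Γ as} → ts ⇝ˢ ts' → pvar {Ψ = Ψ} x ts ⟶ᶠ pvar x ts'
    ≐ˡ    : ∀ {Γ Φ Ψ A} {t t' u : Tm Γ A} → t ⇝ t' → _≐_ {Φ = Φ} {Ψ} t u ⟶ᶠ (t' ≐ u)
    ≐ʳ    : ∀ {Γ Φ Ψ A} {t u u' : Tm Γ A} → u ⇝ u' → _≐_ {Φ = Φ} {Ψ} t u ⟶ᶠ (t ≐ u')
    ⊃ˡ    : ∀ {Γ Φ Ψ} {A A' : Fm Γ Ψ Φ} {B : Fm Γ Φ Ψ} → A ⟶ᶠ A' → (A ⊃ B) ⟶ᶠ (A' ⊃ B)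
    ⊃ʳ    : ∀ {Γ Φ Ψ} {A : Fm Γ Ψ Φ} {B B' : Fm Γ Φ Ψ} → B ⟶ᶠ B' → (A ⊃ B) ⟶ᶠ (A ⊃ B')
    ∧ˡ    : ∀ {Γ Φ Ψ} {A A' B : Fm Γ Φ Ψ} → A ⟶ᶠ A' → (A ∧ᶠ B) ⟶ᶠ (A' ∧ᶠ B)
    ∧ʳ    : ∀ {Γ Φ Ψ} {A B B' : Fm Γ Φ Ψ} → B ⟶ᶠ B' → (A ∧ᶠ B) ⟶ᶠ (A ∧ᶠ B')
    ∨ˡ    : ∀ {Γ Φ Ψ} {A A' B : Fm Γ Φ Ψ} → A ⟶ᶠ A' → (A ∨ᶠ B) ⟶ᶠ (A' ∨ᶠ B)
    ∨ʳ    : ∀ {Γ Φ Ψ} {A B B' : Fm Γ Φ Ψ} → B ⟶ᶠ B' → (A ∨ᶠ B) ⟶ᶠ (A ∨ᶠ B')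
    allᶜ  : ∀ {Γ Φ Ψ A} {F F' : Fm (A ∷ Γ) Φ Ψ} → F ⟶ᶠ F' → Forall A F ⟶ᶠ Forall A F'
    exᶜ   : ∀ {Γ Φ Ψ A} {F F' : Fm (A ∷ Γ) Φ Ψ} → F ⟶ᶠ F' → Exists A F ⟶ᶠ Exists A F'
    μB    : ∀ {Γ Φ Ψ as} {B B' : Fm (as ++ Γ) (as ∷ Φ) Ψ} {ts : Tms Γ as} → B ⟶ᶠ B' → μᶠ as B ts ⟶ᶠ μᶠ as B' ts
    μt    : ∀ {Γ Φ Ψ as} {B : Fm (as ++ Γ) (as ∷ Φ) Ψ} {ts ts' : Tms Γ as} → ts ⇝ˢ ts' → μᶠ as B ts ⟶ᶠ μᶠ as B ts'
    νB    : ∀ {Γ Φ Ψ as} {B B' : Fm (as ++ Γ) (as ∷ Φ) Ψ} {ts : Tms Γ as} → B ⟶ᶠ B' → νᶠ as B ts ⟶ᶠ νᶠ as B' ts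
    νt    : ∀ {Γ Φ Ψ as} {B : Fm (as ++ Γ) (as ∷ Φ) Ψ} {ts ts' : Tms Γ as} → ts ⇝ˢ ts' → νᶠ as B ts ⟶ᶠ νᶠ as B ts'

  _≡ₜ_ : ∀ {Γ A} → Tm Γ A → Tm Γ A → Set
  _≡ₜ_ = EqClosure _⇝_

  _≅_ : ∀ {Γ Φ Ψ} → Fm Γ Φ Ψ → Fm Γ Φ Ψ → Set
  _≅_ = EqClosure _⟶ᶠ_

  Confluent : ∀ {X : Set} → (X → X → Set) → Set
  Confluent _↦_ = ∀ {a b c} → Star _↦_ a b → Star _↦_ a c →
                  ∃ λ d → Star _↦_ b d × Star _↦_ c d

  ConfluentRS : Set
  ConfluentRS = (∀ {Γ A} → Confluent (_⇝_ {Γ} {A}))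
              × (∀ {Γ Φ Ψ} → Confluent (_⟶ᶠ_ {Γ} {Φ} {Ψ}))

  record CSU {X A} (u v : Tm X A) (I : Set) (Y : I → Ctx) (θ : (i : I) → Sub X (Y i)) : Set where
    field
      unifies  : ∀ i → sub (θ i) u ≡ₜ sub (θ i) v
      complete : ∀ {Z} (ρ : Sub X Z) → sub ρ u ≡ₜ sub ρ v →
                 ∃ λ i → ∃ λ (ρ' : Sub (Y i) Z) → ρ ≈ˢ (ρ' ∘ˢ θ i)

  -- proof terms together with their typing derivations (Curry–Howard)
  Hyps : Ctx → Set
  Hyps Ξ = List (Form Ξ)

  wkH : ∀ {Ξ Ξ'} → Ren Ξ Ξ' → Hyps Ξ → Hyps Ξ'
  wkH ρ = map (frenF ρ)

  subH : ∀ {Ξ Ξ'} → Sub Ξ Ξ' → Hyps Ξ → Hyps Ξ'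
  subH θ = map (fsub θ)

  infix 3 _⨾_⊢_
  data _⨾_⊢_ : (Ξ : Ctx) → Hyps Ξ → Form Ξ → Set₁ where
    hyp   : ∀ {Ξ Γ P Q} → Γ ∋ Q → P ≅ Q → Ξ ⨾ Γ ⊢ P
    ⊤I    : ∀ {Ξ Γ P} → P ≅ ⊤ᶠ → Ξ ⨾ Γ ⊢ P
    ⊥E    : ∀ {Ξ Γ P} → Ξ ⨾ Γ ⊢ ⊥ᶠ → Ξ ⨾ Γ ⊢ P
    ⊃I    : ∀ {Ξ Γ P} (P₁ P₂ : Form Ξ) → Ξ ⨾ (P₁ ∷ Γ) ⊢ P₂ → P ≅ (P₁ ⊃ P₂) → Ξ ⨾ Γ ⊢ P
    ⊃E    : ∀ {Ξ Γ P Q} → Ξ ⨾ Γ ⊢ (Q ⊃ P) → Ξ ⨾ Γ ⊢ Q → Ξ ⨾ Γ ⊢ P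
    ∧I    : ∀ {Ξ Γ P P₁ P₂} → Ξ ⨾ Γ ⊢ P₁ → Ξ ⨾ Γ ⊢ P₂ → P ≅ (P₁ ∧ᶠ P₂) → Ξ ⨾ Γ ⊢ P
    ∧E₁   : ∀ {Ξ Γ P P₁ P₂} → Ξ ⨾ Γ ⊢ (P₁ ∧ᶠ P₂) → P ≅ P₁ → Ξ ⨾ Γ ⊢ P
    ∧E₂   : ∀ {Ξ Γ P P₁ P₂} → Ξ ⨾ Γ ⊢ (P₁ ∧ᶠ P₂) → P ≅ P₂ → Ξ ⨾ Γ ⊢ P
    ∨I₁   : ∀ {Ξ Γ P P₁ P₂} → Ξ ⨾ Γ ⊢ P₁ → P ≅ (P₁ ∨ᶠ P₂) → Ξ ⨾ Γ ⊢ P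
    ∨I₂   : ∀ {Ξ Γ P P₁ P₂} → Ξ ⨾ Γ ⊢ P₂ → P ≅ (P₁ ∨ᶠ P₂) → Ξ ⨾ Γ ⊢ P
    ∨E    : ∀ {Ξ Γ P P₁ P₂} → Ξ ⨾ Γ ⊢ (P₁ ∨ᶠ P₂) → Ξ ⨾ (P₁ ∷ Γ) ⊢ P → Ξ ⨾ (P₂ ∷ Γ) ⊢ P → Ξ ⨾ Γ ⊢ P
    allI  : ∀ {Ξ Γ P A} (Q : Form (A ∷ Ξ)) → (A ∷ Ξ) ⨾ wkH there Γ ⊢ Q → P ≅ Forall A Q → Ξ ⨾ Γ ⊢ P
    allE  : ∀ {Ξ Γ P A Q} → Ξ ⨾ Γ ⊢ Forall A Q → (t : Tm Ξ A) → P ≅ (Q [ t ]ᶠ) → Ξ ⨾ Γ ⊢ P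
    exI   : ∀ {Ξ Γ P A} (Q : Form (A ∷ Ξ)) (t : Tm Ξ A) → Ξ ⨾ Γ ⊢ (Q [ t ]ᶠ) → P ≅ Exists A Q → Ξ ⨾ Γ ⊢ P
    exE   : ∀ {Ξ Γ P A Q} → Ξ ⨾ Γ ⊢ Exists A Q → (A ∷ Ξ) ⨾ (Q ∷ wkH there Γ) ⊢ frenF there P → Ξ ⨾ Γ ⊢ P
    reflI : ∀ {Ξ Γ P A} (t : Tm Ξ A) → P ≅ (t ≐ t) → Ξ ⨾ Γ ⊢ P
    ≐E    : ∀ {Ξ Γ P X A} (Γ₀ : Hyps X) (θ : Sub X Ξ) (σ : ∀ {R} → Γ₀ ∋ R → Ξ ⨾ Γ ⊢ fsub θ R)
            (u v : Tm X A) (Q : Form X) →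
            Ξ ⨾ Γ ⊢ (sub θ u ≐ sub θ v) →
            (I : Set) (Y : I → Ctx) (θ' : (i : I) → Sub X (Y i)) → CSU u v I Y θ' →
            ((i : I) → Y i ⨾ subH (θ' i) Γ₀ ⊢ fsub (θ' i) Q) →
            P ≅ fsub θ Q → Ξ ⨾ Γ ⊢ P
    μI    : ∀ {Ξ Γ P as} (B : Body Ξ as) (ts : Tms Ξ as) → Ξ ⨾ Γ ⊢ unfoldμ B ts → P ≅ μᶠ as B ts → Ξ ⨾ Γ ⊢ P
    μE    : ∀ {Ξ Γ P as} {B : Body Ξ as} {ts : Tms Ξ as} → Ξ ⨾ Γ ⊢ μᶠ as B ts →
            (S : Form (as ++ Ξ)) → (as ++ Ξ) ⨾ (applyB B S ∷ wkH (wkN as) Γ) ⊢ S →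
            P ≅ inst S ts → Ξ ⨾ Γ ⊢ P
    νI    : ∀ {Ξ Γ P as} (B : Body Ξ as) (ts : Tms Ξ as) (S : Form (as ++ Ξ)) →
            Ξ ⨾ Γ ⊢ inst S ts → (as ++ Ξ) ⨾ (S ∷ wkH (wkN as) Γ) ⊢ applyB B S →
            P ≅ νᶠ as B ts → Ξ ⨾ Γ ⊢ P
    νE    : ∀ {Ξ Γ P as} {B : Body Ξ as} {ts : Tms Ξ as} → Ξ ⨾ Γ ⊢ νᶠ as B ts →
            P ≅ unfoldν B ts → Ξ ⨾ Γ ⊢ P

  Is⊃I Is∀I Is∃I Is∨I IsμI IsνI IsRefl : ∀ {Ξ Γ P} → Ξ ⨾ Γ ⊢ P → Set
  Is⊃I (⊃I _ _ _ _) = ⊤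
  Is⊃I _ = ⊥
  Is∀I (allI _ _ _) = ⊤
  Is∀I _ = ⊥
  Is∃I (exI _ _ _ _) = ⊤
  Is∃I _ = ⊥
  Is∨I (∨I₁ _ _) = ⊤
  Is∨I (∨I₂ _ _) = ⊤
  Is∨I _ = ⊥
  IsμI (μI _ _ _ _) = ⊤
  IsμI _ = ⊥
  IsνI (νI _ _ _ _ _ _) = ⊤
  IsνI _ = ⊥
  IsRefl (reflI _ _) = ⊤
  IsRefl _ = ⊥

  Is∧I : ∀ {Ξ Γ P} → Ξ ⨾ Γ ⊢ P → Set
  Is∧I (∧I _ _ _) = ⊤
  Is∧I _ = ⊥

  Normal : ∀ {Ξ Γ P} → Ξ ⨾ Γ ⊢ P → Set
  Normal (hyp _ _) = ⊤
  Normal (⊤I _) = ⊤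
  Normal (⊥E d) = Normal d
  Normal (⊃I _ _ d _) = Normal d
  Normal (⊃E d e) = ¬ Is⊃I d × Normal d × Normal e
  Normal (∧I d e _) = Normal d × Normal e
  Normal (∧E₁ d _) = ¬ Is∧I d × Normal d
  Normal (∧E₂ d _) = ¬ Is∧I d × Normal d
  Normal (∨I₁ d _) = Normal d
  Normal (∨I₂ d _) = Normal d
  Normal (∨E d e f) = ¬ Is∨I d × Normal d × Normal e × Normal f
  Normal (allI _ d _) = Normal d
  Normal (allE d _ _) = ¬ Is∀I d × Normal d
  Normal (exI _ _ d _) = Normal d
  Normal (exE d e) = ¬ Is∃I d × Normal d × Normal e
  Normal (reflI _ _) = ⊤
  Normal (≐E {Ξ = Ξ} Γ₀ θ σ u v Q d I Y θ' _ ds _) =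
    ¬ (IsRefl d × ∃ λ i → ∃ λ (θ'' : Sub (Y i) Ξ) → θ ≈ˢ (θ'' ∘ˢ θ' i))
    × Normal d × (∀ {R} (β : Γ₀ ∋ R) → Normal (σ β)) × (∀ i → Normal (ds i))
  Normal (μI _ _ d _) = Normal d
  Normal (μE d _ e _) = ¬ IsμI d × Normal d × Normal e
  Normal (νI _ _ _ d e _) = Normal d × Normal e
  Normal (νE d _) = ¬ IsνI d × Normal d

module Submission where

-- A rewrite step on formulas only ever replaces an atom, so along a reduction the
-- main connective of a non-atomic formula never changes; with confluence, two
-- congruent non-atomic formulas therefore have the same main connective.  Now
-- argue by induction on a normal proof in the empty hypothesis context.  Such a
-- proof cannot be an axiom, and an elimination would have as major premise a
-- normal proof, in the same empty context, of a non-atomic formula; by induction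
-- this premise is the matching introduction, which makes a redex.  So the proof
-- ends with the introduction of the main connective of its conclusion, and ⊥ has
-- none.  For δ₌ the major premise is refl(w) : uθ = vθ, so uθ ≡ vθ, and
-- completeness of the csu makes θ an instance of one of its unifiers: a redex.

open import Defs
open import Data.List using ([])
open import Data.Product using (∃; ∃₂; _×_; _,_; proj₂)
open import Data.Unit using (⊤; tt)
open import Data.Empty using (⊥; ⊥-elim)
open import Relation.Nullary using (¬_)
open import Relation.Binary.Core using (Rel)
open import Relation.Binary.PropositionalEquality using (_≡_; _≢_; refl; sym; trans; subst)
open import Relation.Binary.Construct.Closure.ReflexiveTransitive using (Star; ε; _◅_; _◅◅_)
open import Relation.Binary.Construct.Closure.Symmetric using (fwd; bwd)
open import Relation.Binary.Construct.Closure.Equivalence using (EqClosure)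
open import Relation.Binary.Construct.Closure.Equivalence.Properties
  using (a—↠b⇒a↔b; a—↠b⇒b↔a; a—↠b&a—↠c⇒b↔c)
open import Relation.Binary.Rewriting using (Confluent)

module _ {a ℓ} {A : Set a} {_⟶_ : Rel A ℓ} where

  confluent⇒joinable : Confluent _⟶_ → ∀ {x y} → EqClosure _⟶_ x y →
                       ∃ λ z → Star _⟶_ x z × Star _⟶_ y z
  confluent⇒joinable conf ε = _ , ε , ε
  confluent⇒joinable conf (fwd x⟶ ◅ ↔y) with confluent⇒joinable conf ↔y
  ... | z , ↠z , y↠z = z , x⟶ ◅ ↠z , y↠z
  confluent⇒joinable conf (bwd ⟶x ◅ ↔y) with confluent⇒joinable conf ↔y
  ... | z , ↠z , y↠z with conf ↠z (⟶x ◅ ε)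
  ... | w , z↠w , x↠w = w , x↠w , y↠z ◅◅ z↠w

module _ (sig : Signature) (R : Syntax.RewriteSystem sig) where
  open Syntax sig
  open Logic sig R hiding (Confluent)

  data Head : Set where
    ⊤ʰ ⊥ʰ ⊃ʰ ∧ʰ ∨ʰ ∀ʰ ∃ʰ ≐ʰ μʰ νʰ pvarʰ atomʰ : Head

  head : ∀ {Γ Φ Ψ} → Fm Γ Φ Ψ → Head
  head ⊤ᶠ           = ⊤ʰ
  head ⊥ᶠ           = ⊥ʰ
  head (_ ⊃ _)      = ⊃ʰ
  head (_ ∧ᶠ _)     = ∧ʰ
  head (_ ∨ᶠ _)     = ∨ʰ
  head (Forall _ _) = ∀ʰ
  head (Exists _ _) = ∃ʰ
  head (_ ≐ _)      = ≐ʰ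
  head (μᶠ _ _ _)   = μʰ
  head (νᶠ _ _ _)   = νʰ
  head (pvar _ _)   = pvarʰ
  head (atom _ _)   = atomʰ

  ⟶ᶠ-head : ∀ {Γ Φ Ψ} {A B : Fm Γ Φ Ψ} → A ⟶ᶠ B → head A ≢ atomʰ → head B ≡ head A
  ⟶ᶠ-head (rw _ _)  A≢atom = ⊥-elim (A≢atom refl)
  ⟶ᶠ-head (atomᶜ _) _ = refl
  ⟶ᶠ-head (pvarᶜ _) _ = refl
  ⟶ᶠ-head (≐ˡ _)    _ = refl
  ⟶ᶠ-head (≐ʳ _)    _ = refl
  ⟶ᶠ-head (⊃ˡ _)    _ = refl
  ⟶ᶠ-head (⊃ʳ _)    _ = refl
  ⟶ᶠ-head (∧ˡ _)    _ = refl
  ⟶ᶠ-head (∧ʳ _)    _ = refl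
  ⟶ᶠ-head (∨ˡ _)    _ = refl
  ⟶ᶠ-head (∨ʳ _)    _ = refl
  ⟶ᶠ-head (allᶜ _)  _ = refl
  ⟶ᶠ-head (exᶜ _)   _ = refl
  ⟶ᶠ-head (μB _)    _ = refl
  ⟶ᶠ-head (μt _)    _ = refl
  ⟶ᶠ-head (νB _)    _ = refl
  ⟶ᶠ-head (νt _)    _ = refl

  ↠ᶠ-head : ∀ {Γ Φ Ψ} {A B : Fm Γ Φ Ψ} → Star _⟶ᶠ_ A B → head A ≢ atomʰ → head B ≡ head A
  ↠ᶠ-head ε _ = refl
  ↠ᶠ-head (A⟶ ◅ ↠B) A≢atom =
    trans (↠ᶠ-head ↠B (λ h → A≢atom (trans (sym step) h))) step
    where step = ⟶ᶠ-head A⟶ A≢atom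

  ≐-reduct : ∀ {Γ Φ Ψ A} {a b : Tm Γ A} {D : Fm Γ Φ Ψ} → Star _⟶ᶠ_ (a ≐ b) D →
             ∃₂ λ a' b' → D ≡ (a' ≐ b') × Star _⇝_ a a' × Star _⇝_ b b'
  ≐-reduct ε = _ , _ , refl , ε , ε
  ≐-reduct (≐ˡ a⇝ ◅ ↠D) with ≐-reduct ↠D
  ... | a' , b' , D≡ , a↠ , b↠ = a' , b' , D≡ , a⇝ ◅ a↠ , b↠
  ≐-reduct (≐ʳ b⇝ ◅ ↠D) with ≐-reduct ↠D
  ... | a' , b' , D≡ , a↠ , b↠ = a' , b' , D≡ , a↠ , b⇝ ◅ b↠

  Is⊤I : ∀ {Ξ Γ P} → Ξ ⨾ Γ ⊢ P → Set
  Is⊤I (⊤I _) = ⊤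
  Is⊤I _      = ⊥

  IsIntroOf : ∀ {Ξ Γ P} → Head → Ξ ⨾ Γ ⊢ P → Set
  IsIntroOf ⊤ʰ    = Is⊤I
  IsIntroOf ⊃ʰ    = Is⊃I
  IsIntroOf ∧ʰ    = Is∧I
  IsIntroOf ∨ʰ    = Is∨I
  IsIntroOf ∀ʰ    = Is∀I
  IsIntroOf ∃ʰ    = Is∃I
  IsIntroOf ≐ʰ    = IsRefl
  IsIntroOf μʰ    = IsμI
  IsIntroOf νʰ    = IsνI
  IsIntroOf ⊥ʰ    _ = ⊥
  IsIntroOf pvarʰ _ = ⊥
  IsIntroOf atomʰ _ = ⊥

  module _ (confluent : ∀ {Γ Φ Ψ} → Confluent (_⟶ᶠ_ {Γ} {Φ} {Ψ})) where

    ≅-head : ∀ {Γ Φ Ψ} {A B : Fm Γ Φ Ψ} → A ≅ B → head A ≢ atomʰ → head B ≢ atomʰ →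
             head A ≡ head B
    ≅-head A≅B A≢atom B≢atom with confluent⇒joinable confluent A≅B
    ... | D , A↠D , B↠D = trans (sym (↠ᶠ-head A↠D A≢atom)) (↠ᶠ-head B↠D B≢atom)

    ≐-≅-trivial⇒≡ₜ : ∀ {Γ Φ Ψ A B} {a b : Tm Γ A} {t : Tm Γ B} →
                     _≅_ {Γ} {Φ} {Ψ} (a ≐ b) (t ≐ t) → a ≡ₜ b
    ≐-≅-trivial⇒≡ₜ a≐b≅t≐t with confluent⇒joinable confluent a≐b≅t≐t
    ... | D , ↠D , ↠D' with ≐-reduct ↠D | ≐-reduct ↠D'
    ... | a' , b' , refl , a↠ , b↠ | _ , _ , refl , t↠a' , t↠b' =
      a—↠b⇒a↔b a↠ ◅◅ a—↠b&a—↠c⇒b↔c t↠a' t↠b' ◅◅ a—↠b⇒b↔a b↠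

    refl-≡ₜ : ∀ {Ξ Γ A} {a b : Tm Ξ A} (d : Ξ ⨾ Γ ⊢ (a ≐ b)) → IsRefl d → a ≡ₜ b
    refl-≡ₜ (reflI _ a≐b≅t≐t) _ = ≐-≅-trivial⇒≡ₜ a≐b≅t≐t

    introduces : ∀ {Ξ Γ P F} (d : Ξ ⨾ Γ ⊢ P) → P ≅ F →
                 head P ≢ atomʰ → head F ≢ atomʰ →
                 IsIntroOf (head F) d → IsIntroOf (head P) d
    introduces d P≅F P≢atom F≢atom =
      subst (λ h → IsIntroOf h d) (sym (≅-head P≅F P≢atom F≢atom))

    closed-normal⇒intro : ∀ {Ξ P} (d : Ξ ⨾ [] ⊢ P) → Normal d → head P ≢ atomʰ →
                          IsIntroOf (head P) d
    closed-normal⇒intro (hyp () _)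
    closed-normal⇒intro d@(⊤I eq)             _ ≢atom = introduces d eq ≢atom (λ ()) tt
    closed-normal⇒intro d@(⊃I _ _ _ eq)       _ ≢atom = introduces d eq ≢atom (λ ()) tt
    closed-normal⇒intro d@(∧I _ _ eq)         _ ≢atom = introduces d eq ≢atom (λ ()) tt
    closed-normal⇒intro d@(∨I₁ _ eq)          _ ≢atom = introduces d eq ≢atom (λ ()) tt
    closed-normal⇒intro d@(∨I₂ _ eq)          _ ≢atom = introduces d eq ≢atom (λ ()) tt
    closed-normal⇒intro d@(allI _ _ eq)       _ ≢atom = introduces d eq ≢atom (λ ()) tt
    closed-normal⇒intro d@(exI _ _ _ eq)      _ ≢atom = introduces d eq ≢atom (λ ()) tt
    closed-normal⇒intro d@(reflI _ eq)        _ ≢atom = introduces d eq ≢atom (λ ()) tt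
    closed-normal⇒intro d@(μI _ _ _ eq)       _ ≢atom = introduces d eq ≢atom (λ ()) tt
    closed-normal⇒intro d@(νI _ _ _ _ _ eq)   _ ≢atom = introduces d eq ≢atom (λ ()) tt
    closed-normal⇒intro (⊥E d) nd _ = ⊥-elim (closed-normal⇒intro d nd (λ ()))
    closed-normal⇒intro (⊃E d _) (¬I , nd , _) _ = ⊥-elim (¬I (closed-normal⇒intro d nd (λ ())))
    closed-normal⇒intro (∧E₁ d _) (¬I , nd) _ = ⊥-elim (¬I (closed-normal⇒intro d nd (λ ())))
    closed-normal⇒intro (∧E₂ d _) (¬I , nd) _ = ⊥-elim (¬I (closed-normal⇒intro d nd (λ ())))
    closed-normal⇒intro (∨E d _ _) (¬I , nd , _) _ = ⊥-elim (¬I (closed-normal⇒intro d nd (λ ())))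
    closed-normal⇒intro (allE d _ _) (¬I , nd) _ = ⊥-elim (¬I (closed-normal⇒intro d nd (λ ())))
    closed-normal⇒intro (exE d _) (¬I , nd , _) _ = ⊥-elim (¬I (closed-normal⇒intro d nd (λ ())))
    closed-normal⇒intro (μE d _ _ _) (¬I , nd , _) _ = ⊥-elim (¬I (closed-normal⇒intro d nd (λ ())))
    closed-normal⇒intro (νE d _) (¬I , nd) _ = ⊥-elim (¬I (closed-normal⇒intro d nd (λ ())))
    closed-normal⇒intro (≐E _ θ _ _ _ _ d _ _ _ csu _ _) (¬redex , nd , _) _ =
      ⊥-elim (¬redex (isRefl , CSU.complete csu θ (refl-≡ₜ d isRefl)))
      where isRefl = closed-normal⇒intro d nd (λ ())

lemma3 : (sig : Signature) (R : Syntax.RewriteSystem sig) →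
    Logic.ConfluentRS sig R →
    (π : Logic._⨾_⊢_ sig R [] [] Syntax.⊥ᶠ) → ¬ Logic.Normal sig R π
lemma3 sig R conf π normal = closed-normal⇒intro sig R (proj₂ conf) π normal (λ ())
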